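{- Let $\Phi$ be an irreducible crystallographic root system, $\alpha\in\Phi^+$, and $\omega\in\widetilde W$ dominant with $\omega=t_qs$, $q\in Q^\vee$, $s\in W$. If $\langle\alpha,q\rangle=0$ then $s^{ -1}\cdot\alpha\in\Phi^+$.
   Context: $\Phi$ lies in a Euclidean space $V$ with inner product $\langle\cdot,\cdot\rangle$, positive system $\Phi^+$, simple system $\Delta$, highest root $\tilde\alpha$. $W$ is the Weyl group, $Q^\vee$ the coroot lattice spanned by $2\alpha/\langle\alpha,\alpha\rangle$, and $\widetilde W=W\ltimes Q^\vee$, where $t_qs$ acts on $V$ by $x\mapsto q+s(x)$. The fundamental alcove is $A_0=\{x\in V:\langle x,\beta\rangle>0\ \forall\beta\in\Delta,\ \langle x,\tilde\alpha\rangle<1\}$ and the dominant chamber is $C=\{x\in V:\langle x,\beta\rangle>0\ \forall\beta\in\Delta\}$; $\omega\in\widetilde W$ is dominant if $\omega(A_0)\subseteq C$.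
   Formalization: The space $V$ is taken as ℚ^n with an inner product that takes rational values, so the roots, the coroot lattice and the alcove $A_0$ consist of points with rational coordinates. -}

module Defs where

open import Data.Nat using (ℕ; zero; suc)
open import Data.Integer using (ℤ)
open import Data.Rational
  using (ℚ; 0ℚ; 1ℚ; _+_; _*_; _-_; -_; _<_; _≤_; _≟_; 1/_; _/_; ≢-nonZero)
open import Data.Fin using (Fin; zero; suc)
open import Data.List using (List; length; lookup; foldr; reverse)
open import Data.Product using (Σ; ∃; _×_)
open import Data.Sum using (_⊎_)
open import Data.Bool using (Bool; true; false)
open import Relation.Nullary using (¬_; yes; no)
open import Relation.Binary.PropositionalEquality using (_≡_)

V : ℕ → Set
V n = Fin n → ℚ

infix 4 _≈ᵥ_
_≈ᵥ_ : ∀ {n} → V n → V n → Set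
x ≈ᵥ y = ∀ i → x i ≡ y i

0ᵥ : ∀ {n} → V n
0ᵥ _ = 0ℚ

infixl 6 _+ᵥ_ _-ᵥ_
infixl 7 _·ᵥ_
_+ᵥ_ : ∀ {n} → V n → V n → V n
(x +ᵥ y) i = x i + y i

_-ᵥ_ : ∀ {n} → V n → V n → V n
(x -ᵥ y) i = x i - y i

_·ᵥ_ : ∀ {n} → ℚ → V n → V n
(c ·ᵥ x) i = c * x i

sumF : ∀ {m} → (Fin m → ℚ) → ℚ
sumF {zero}  f = 0ℚ
sumF {suc m} f = f zero + sumF (λ i → f (suc i))

comb : ∀ {m n} → (Fin m → V n) → (Fin m → ℚ) → V n
comb v c i = sumF (λ j → c j * v j i)

form : ∀ {n} → (Fin n → Fin n → ℚ) → V n → V n → ℚ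
form G x y = sumF (λ i → sumF (λ j → x i * G i j * y j))

-- total inverse on ℚ (1/0 := 0); only ever applied to ⟨α,α⟩ ≠ 0
inv : ℚ → ℚ
inv p with p ≟ 0ℚ
... | yes _ = 0ℚ
... | no p≢0 = 1/_ p {{≢-nonZero p≢0}}

2ℚ : ℚ
2ℚ = 1ℚ + 1ℚ

record RootSystem (n : ℕ) : Set where
  field
    G      : Fin n → Fin n → ℚ
    G-sym  : ∀ i j → G i j ≡ G j i
    G-pos  : ∀ (x : V n) → ¬ (x ≈ᵥ 0ᵥ) → 0ℚ < form G x x
    Φ      : List (V n)

  ⟪_,_⟫ : V n → V n → ℚ
  ⟪ x , y ⟫ = form G x y

  root : Fin (length Φ) → V n
  root = lookup Φ

  _∈Φ : V n → Set
  v ∈Φ = Σ (Fin (length Φ)) (λ i → root i ≈ᵥ v)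

  coroot : V n → V n
  coroot α = (2ℚ * inv ⟪ α , α ⟫) ·ᵥ α

  reflect : V n → V n → V n
  reflect α x = x -ᵥ (⟪ x , coroot α ⟫ ·ᵥ α)

  field
    spans   : ∀ (v : V n) → ∃ (λ (c : Fin (length Φ) → ℚ) → v ≈ᵥ comb root c)
    nonzero : ∀ i → ¬ (root i ≈ᵥ 0ᵥ)
    reduced : ∀ i (c : ℚ) → (c ·ᵥ root i) ∈Φ → c ≡ 1ℚ ⊎ c ≡ - 1ℚ
    reflect-closed : ∀ i j → (reflect (root i) (root j)) ∈Φ
    crystallographic : ∀ i j → ∃ (λ (k : ℤ) → ⟪ root j , coroot (root i) ⟫ ≡ k / 1)

module _ {n : ℕ} (R : RootSystem n) where
  open RootSystem R

  Irreducible : Set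
  Irreducible = ∀ (P : Fin (length Φ) → Bool) →
    (∀ i j → P i ≡ true → P j ≡ false → ⟪ root i , root j ⟫ ≡ 0ℚ) →
    (∀ i → P i ≡ true) ⊎ (∀ i → P i ≡ false)

  IsSimpleSystem : (Fin n → V n) → Set
  IsSimpleSystem Δ =
    (∀ j → Δ j ∈Φ) ×
    (∀ (c : Fin n → ℚ) → comb Δ c ≈ᵥ 0ᵥ → ∀ j → c j ≡ 0ℚ) ×
    (∀ i → ∃ (λ (c : Fin n → ℚ) → root i ≈ᵥ comb Δ c ×
                 ((∀ j → 0ℚ ≤ c j) ⊎ (∀ j → c j ≤ 0ℚ))))

  NonNegComb : (Fin n → V n) → V n → Set
  NonNegComb Δ v = ∃ (λ (c : Fin n → ℚ) → v ≈ᵥ comb Δ c × (∀ j → 0ℚ ≤ c j))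

  IsPositive : (Fin n → V n) → V n → Set
  IsPositive Δ v = v ∈Φ × NonNegComb Δ v

  IsHighestRoot : (Fin n → V n) → V n → Set
  IsHighestRoot Δ αt = αt ∈Φ × (∀ i → NonNegComb Δ (αt -ᵥ root i))

  -- elements of W as words in the reflections s_β (β ∈ Φ);
  -- the word [i₁,…,i_k] denotes s_{β_{i₁}} ∘ ⋯ ∘ s_{β_{i_k}}
  Word : Set
  Word = List (Fin (length Φ))

  act : Word → V n → V n
  act w x = foldr (λ i y → reflect (root i) y) x w

  inverse : Word → Word
  inverse = reverse

  InCorootLattice : V n → Set
  InCorootLattice q = ∃ (λ (k : Fin (length Φ) → ℤ) →
    q ≈ᵥ comb (λ i → coroot (root i)) (λ i → k i / 1))

  InA0 : (Fin n → V n) → V n → V n → Set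
  InA0 Δ αt x = (∀ j → 0ℚ < ⟪ x , Δ j ⟫) × ⟪ x , αt ⟫ < 1ℚ

  InC : (Fin n → V n) → V n → Set
  InC Δ x = ∀ j → 0ℚ < ⟪ x , Δ j ⟫

  -- ω = t_q s acts by x ↦ q + s(x); ω is dominant iff ω(A₀) ⊆ C
  affAct : V n → Word → V n → V n
  affAct q w x = q +ᵥ act w x

  Dominant : (Fin n → V n) → V n → V n → Word → Set
  Dominant Δ αt q w = ∀ (x : V n) → InA0 Δ αt x → InC Δ (affAct q w x)

-- Take any point x of the fundamental alcove. Dominance puts q + s(x) in the
-- dominant chamber, so the positive root α pairs positively with it; as α ⟂ q,
-- this says ⟨s⁻¹α, x⟩ = ⟨α, s(x)⟩ > 0. But x is positive on every simple root,
-- so it pairs non-positively with every negative root; hence the root s⁻¹α is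
-- positive. A point of the alcove exists because the simple roots are linearly
-- independent, so ⟨x, Δⱼ⟩ can be prescribed to be a small positive constant.
module Submission where

open import Data.Empty using (⊥-elim)
open import Data.Fin using (Fin; zero; suc)
open import Data.Fin.Properties using (¬∀⟶∃¬)
open import Data.List using ([]; _∷_; _∷ʳ_; reverse; length)
import Data.List.Properties as List
open import Data.Nat using (ℕ; zero; suc)
open import Data.Product using (∃; _×_; _,_; proj₁; proj₂)
open import Data.Rational
  using (ℚ; 0ℚ; 1ℚ; _+_; _*_; _-_; -_; _<_; _≤_; _≟_; positive; nonNegative; ≢-nonZero)
import Data.Rational.Properties as ℚ
open import Data.Rational.Solver using (module +-*-Solver)
open +-*-Solver using (solve; _:=_; _:+_; _:-_; _:*_; :-_; con)
open import Data.Sum using (inj₁; inj₂)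
open import Relation.Binary.Definitions using (tri<; tri≈; tri>)
open import Relation.Binary.PropositionalEquality
open import Relation.Nullary using (¬_; yes; no)
open ≡-Reasoning

open import Defs

≤∧≢⇒< : ∀ {p q : ℚ} → p ≤ q → p ≢ q → p < q
≤∧≢⇒< {p} {q} p≤q p≢q with ℚ.<-cmp p q
... | tri< p<q _ _ = p<q
... | tri≈ _ p≡q _ = ⊥-elim (p≢q p≡q)
... | tri> _ _ q<p = ⊥-elim (ℚ.<-irrefl refl (ℚ.<-≤-trans q<p p≤q))

*-pos : ∀ {p q : ℚ} → 0ℚ < p → 0ℚ < q → 0ℚ < p * q
*-pos {p} {q} 0<p 0<q =
  subst (_< p * q) (ℚ.*-zeroˡ q) (ℚ.*-monoˡ-<-pos q {{positive 0<q}} 0<p)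

*-nonNeg : ∀ {p q : ℚ} → 0ℚ ≤ p → 0ℚ ≤ q → 0ℚ ≤ p * q
*-nonNeg {p} {q} 0≤p 0≤q =
  subst (_≤ p * q) (ℚ.*-zeroˡ q) (ℚ.*-monoʳ-≤-nonNeg q {{nonNegative 0≤q}} 0≤p)

*-nonPos-nonNeg : ∀ {p q : ℚ} → p ≤ 0ℚ → 0ℚ ≤ q → p * q ≤ 0ℚ
*-nonPos-nonNeg {p} {q} p≤0 0≤q =
  subst (p * q ≤_) (ℚ.*-zeroˡ q) (ℚ.*-monoʳ-≤-nonNeg q {{nonNegative 0≤q}} p≤0)

inv-inverseˡ : ∀ {p} → p ≢ 0ℚ → inv p * p ≡ 1ℚ
inv-inverseˡ {p} p≢0 with p ≟ 0ℚ
... | yes p≡0 = ⊥-elim (p≢0 p≡0)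
... | no p≢0′ = ℚ.*-inverseˡ p {{≢-nonZero p≢0′}}

*-inv-cancelʳ : ∀ a {p} → p ≢ 0ℚ → a * inv p * p ≡ a
*-inv-cancelʳ a {p} p≢0 = begin
  a * inv p * p   ≡⟨ ℚ.*-assoc a (inv p) p ⟩
  a * (inv p * p) ≡⟨ cong (a *_) (inv-inverseˡ p≢0) ⟩
  a * 1ℚ          ≡⟨ ℚ.*-identityʳ a ⟩
  a               ∎

inv-pos : ∀ {p} → 0ℚ < p → 0ℚ < inv p
inv-pos {p} 0<p with p ≟ 0ℚ
... | yes p≡0 = ⊥-elim (ℚ.<⇒≢ 0<p (sym p≡0))
... | no _ = ℚ.positive⁻¹ _ {{ℚ.1/pos⇒pos p {{positive 0<p}}}}

small-positive-multiplier : ∀ c → ∃ λ ε → 0ℚ < ε × ε * c < 1ℚ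
small-positive-multiplier c with c ℚ.<? 1ℚ
... | yes c<1 = 1ℚ , ℚ.positive⁻¹ 1ℚ , subst (_< 1ℚ) (sym (ℚ.*-identityˡ c)) c<1
... | no c≮1 = inv (c + 1ℚ) , inv-pos 0<c+1 , ε*c<1
  where
  c<c+1 : c < c + 1ℚ
  c<c+1 = subst (_< c + 1ℚ) (ℚ.+-identityʳ c) (ℚ.+-monoʳ-< c (ℚ.positive⁻¹ 1ℚ))
  0<c+1 : 0ℚ < c + 1ℚ
  0<c+1 = ℚ.<-trans (ℚ.<-≤-trans (ℚ.positive⁻¹ 1ℚ) (ℚ.≮⇒≥ c≮1)) c<c+1
  ε*c<1 : inv (c + 1ℚ) * c < 1ℚ
  ε*c<1 = subst (inv (c + 1ℚ) * c <_) (inv-inverseˡ (λ e → ℚ.<⇒≢ 0<c+1 (sym e)))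
            (ℚ.*-monoʳ-<-pos (inv (c + 1ℚ)) {{positive (inv-pos 0<c+1)}} c<c+1)

sumF-cong : ∀ {m} {f g : Fin m → ℚ} → (∀ i → f i ≡ g i) → sumF f ≡ sumF g
sumF-cong {zero}  f≡g = refl
sumF-cong {suc m} f≡g = cong₂ _+_ (f≡g zero) (sumF-cong (λ i → f≡g (suc i)))

sumF-zero : ∀ m → sumF {m} (λ _ → 0ℚ) ≡ 0ℚ
sumF-zero zero    = refl
sumF-zero (suc m) = cong (0ℚ +_) (sumF-zero m)

sumF-+ : ∀ {m} (f g : Fin m → ℚ) → sumF (λ i → f i + g i) ≡ sumF f + sumF g
sumF-+ {zero}  f g = refl
sumF-+ {suc m} f g = begin
  (f zero + g zero) + sumF (λ i → f (suc i) + g (suc i))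
    ≡⟨ cong ((f zero + g zero) +_) (sumF-+ (λ i → f (suc i)) (λ i → g (suc i))) ⟩
  (f zero + g zero) + (sumF (λ i → f (suc i)) + sumF (λ i → g (suc i)))
    ≡⟨ solve 4 (λ a b c d → (a :+ b) :+ (c :+ d) := (a :+ c) :+ (b :+ d)) refl
         (f zero) (g zero) (sumF (λ i → f (suc i))) (sumF (λ i → g (suc i))) ⟩
  (f zero + sumF (λ i → f (suc i))) + (g zero + sumF (λ i → g (suc i))) ∎

sumF-*ˡ : ∀ {m} (c : ℚ) (f : Fin m → ℚ) → sumF (λ i → c * f i) ≡ c * sumF f
sumF-*ˡ {zero}  c f = sym (ℚ.*-zeroʳ c)
sumF-*ˡ {suc m} c f = begin
  c * f zero + sumF (λ i → c * f (suc i))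
    ≡⟨ cong (c * f zero +_) (sumF-*ˡ c (λ i → f (suc i))) ⟩
  c * f zero + c * sumF (λ i → f (suc i))
    ≡⟨ ℚ.*-distribˡ-+ c (f zero) _ ⟨
  c * (f zero + sumF (λ i → f (suc i))) ∎

sumF-swap : ∀ {m k} (f : Fin m → Fin k → ℚ) →
  sumF (λ i → sumF (λ j → f i j)) ≡ sumF (λ j → sumF (λ i → f i j))
sumF-swap {zero}  {k} f = sym (sumF-zero k)
sumF-swap {suc m} {k} f = begin
  sumF (λ j → f zero j) + sumF (λ i → sumF (λ j → f (suc i) j))
    ≡⟨ cong (sumF (λ j → f zero j) +_) (sumF-swap (λ i j → f (suc i) j)) ⟩
  sumF (λ j → f zero j) + sumF (λ j → sumF (λ i → f (suc i) j))
    ≡⟨ sumF-+ (λ j → f zero j) (λ j → sumF (λ i → f (suc i) j)) ⟨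
  sumF (λ j → f zero j + sumF (λ i → f (suc i) j)) ∎

sumF-nonNeg : ∀ {m} (f : Fin m → ℚ) → (∀ i → 0ℚ ≤ f i) → 0ℚ ≤ sumF f
sumF-nonNeg {zero}  f 0≤f = ℚ.≤-refl
sumF-nonNeg {suc m} f 0≤f = subst (_≤ sumF f) (ℚ.+-identityʳ 0ℚ)
  (ℚ.+-mono-≤ (0≤f zero) (sumF-nonNeg (λ i → f (suc i)) (λ i → 0≤f (suc i))))

sumF-nonPos : ∀ {m} (f : Fin m → ℚ) → (∀ i → f i ≤ 0ℚ) → sumF f ≤ 0ℚ
sumF-nonPos {zero}  f f≤0 = ℚ.≤-refl
sumF-nonPos {suc m} f f≤0 = subst (sumF f ≤_) (ℚ.+-identityʳ 0ℚ)
  (ℚ.+-mono-≤ (f≤0 zero) (sumF-nonPos (λ i → f (suc i)) (λ i → f≤0 (suc i))))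

sumF-pos : ∀ {m} (f : Fin m → ℚ) → (∀ i → 0ℚ ≤ f i) → ∃ (λ i → 0ℚ < f i) → 0ℚ < sumF f
sumF-pos f 0≤f (zero , 0<f₀) = subst (_< sumF f) (ℚ.+-identityʳ 0ℚ)
  (ℚ.+-mono-<-≤ 0<f₀ (sumF-nonNeg (λ i → f (suc i)) (λ i → 0≤f (suc i))))
sumF-pos f 0≤f (suc i , 0<fᵢ) = subst (_< sumF f) (ℚ.+-identityʳ 0ℚ)
  (ℚ.+-mono-≤-< (0≤f zero) (sumF-pos (λ i → f (suc i)) (λ i → 0≤f (suc i)) (i , 0<fᵢ)))

LinearIndependent : ∀ {k n} → (Fin k → V n) → Set
LinearIndependent v = ∀ c → comb v c ≈ᵥ 0ᵥ → ∀ j → c j ≡ 0ℚ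

comb-zero : ∀ {k n} (v : Fin k → V n) {c : Fin k → ℚ} → (∀ j → c j ≡ 0ℚ) → comb v c ≈ᵥ 0ᵥ
comb-zero {k} v {c} c≡0 i = begin
  sumF (λ j → c j * v j i) ≡⟨ sumF-cong (λ j → trans (cong (_* v j i) (c≡0 j)) (ℚ.*-zeroˡ (v j i))) ⟩
  sumF {k} (λ _ → 0ℚ)      ≡⟨ sumF-zero k ⟩
  0ℚ                       ∎

comb-nonzero-coefficient : ∀ {k n} (v : Fin k → V n) (c : Fin k → ℚ) →
  ¬ (comb v c ≈ᵥ 0ᵥ) → ∃ λ j → c j ≢ 0ℚ
comb-nonzero-coefficient v c comb≢0 =
  ¬∀⟶∃¬ _ (λ j → c j ≡ 0ℚ) (λ j → c j ≟ 0ℚ) (λ c≡0 → comb≢0 (comb-zero v c≡0))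

independent-head-nonzero : ∀ {k n} (v : Fin (suc k) → V n) →
  LinearIndependent v → ¬ (v zero ≈ᵥ 0ᵥ)
independent-head-nonzero {k} v independent v₀≡0 with independent δ comb≡0 zero
  where
  δ : Fin (suc k) → ℚ
  δ zero    = 1ℚ
  δ (suc _) = 0ℚ
  comb≡0 : comb v δ ≈ᵥ 0ᵥ
  comb≡0 i = begin
    1ℚ * v zero i + comb (λ j → v (suc j)) (λ _ → 0ℚ) i
      ≡⟨ cong₂ _+_ (ℚ.*-identityˡ (v zero i)) (comb-zero (λ j → v (suc j)) (λ _ → refl) i) ⟩
    v zero i + 0ℚ ≡⟨ ℚ.+-identityʳ (v zero i) ⟩
    v zero i      ≡⟨ v₀≡0 i ⟩
    0ℚ            ∎
... | ()

independent-shear : ∀ {k n} (κ : Fin k → ℚ) (v : Fin (suc k) → V n) → LinearIndependent v →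
  LinearIndependent (λ j → v (suc j) -ᵥ κ j ·ᵥ v zero)
independent-shear κ v independent c comb≡0 j = independent c′ comb′≡0 (suc j)
  where
  c′ : Fin _ → ℚ
  c′ zero    = - sumF (λ j → c j * κ j)
  c′ (suc j) = c j
  comb′≡0 : comb v c′ ≈ᵥ 0ᵥ
  comb′≡0 i = begin
    - sumF (λ j → c j * κ j) * v zero i + sumF (λ j → c j * v (suc j) i)
      ≡⟨ solve 3 (λ s a t → (:- s) :* a :+ t := t :+ (:- a) :* s) refl
           (sumF (λ j → c j * κ j)) (v zero i) (sumF (λ j → c j * v (suc j) i)) ⟩
    sumF (λ j → c j * v (suc j) i) + - v zero i * sumF (λ j → c j * κ j)
      ≡⟨ cong (sumF (λ j → c j * v (suc j) i) +_) (sumF-*ˡ (- v zero i) (λ j → c j * κ j)) ⟨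
    sumF (λ j → c j * v (suc j) i) + sumF (λ j → - v zero i * (c j * κ j))
      ≡⟨ sumF-+ (λ j → c j * v (suc j) i) (λ j → - v zero i * (c j * κ j)) ⟨
    sumF (λ j → c j * v (suc j) i + - v zero i * (c j * κ j))
      ≡⟨ sumF-cong (λ j → solve 4 (λ cⱼ b a kⱼ → cⱼ :* b :+ (:- a) :* (cⱼ :* kⱼ) := cⱼ :* (b :- kⱼ :* a))
           refl (c j) (v (suc j) i) (v zero i) (κ j)) ⟩
    comb (λ j → v (suc j) -ᵥ κ j ·ᵥ v zero) c i ≡⟨ comb≡0 i ⟩
    0ℚ ∎

module BilinearForm {n : ℕ} (G : Fin n → Fin n → ℚ) (G-sym : ∀ i j → G i j ≡ G j i) where

  private
    ⟪_,_⟫ : V n → V n → ℚ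
    ⟪ x , y ⟫ = form G x y

  form-congˡ : ∀ {x x′} (y : V n) → x ≈ᵥ x′ → ⟪ x , y ⟫ ≡ ⟪ x′ , y ⟫
  form-congˡ y x≈x′ = sumF-cong (λ i → sumF-cong (λ j → cong (λ t → t * G i j * y j) (x≈x′ i)))

  form-congʳ : ∀ (x : V n) {y y′} → y ≈ᵥ y′ → ⟪ x , y ⟫ ≡ ⟪ x , y′ ⟫
  form-congʳ x y≈y′ = sumF-cong (λ i → sumF-cong (λ j → cong (x i * G i j *_) (y≈y′ j)))

  form-sym : ∀ x y → ⟪ x , y ⟫ ≡ ⟪ y , x ⟫
  form-sym x y = trans (sumF-swap (λ i j → x i * G i j * y j))
    (sumF-cong (λ j → sumF-cong (λ i → begin
      x i * G i j * y j ≡⟨ cong (λ g → x i * g * y j) (G-sym i j) ⟩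
      x i * G j i * y j ≡⟨ solve 3 (λ a g b → a :* g :* b := b :* g :* a) refl (x i) (G j i) (y j) ⟩
      y j * G j i * x i ∎)))

  form-zeroˡ : ∀ y → ⟪ 0ᵥ , y ⟫ ≡ 0ℚ
  form-zeroˡ y = begin
    ⟪ 0ᵥ , y ⟫
      ≡⟨ sumF-cong (λ i → sumF-cong (λ j → trans (cong (_* y j) (ℚ.*-zeroˡ (G i j))) (ℚ.*-zeroˡ (y j)))) ⟩
    sumF {n} (λ _ → sumF {n} (λ _ → 0ℚ)) ≡⟨ sumF-cong {n} (λ _ → sumF-zero n) ⟩
    sumF {n} (λ _ → 0ℚ)                  ≡⟨ sumF-zero n ⟩
    0ℚ                                   ∎

  form-+ˡ : ∀ x y z → ⟪ x +ᵥ y , z ⟫ ≡ ⟪ x , z ⟫ + ⟪ y , z ⟫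
  form-+ˡ x y z = begin
    ⟪ x +ᵥ y , z ⟫
      ≡⟨ sumF-cong (λ i → sumF-cong (λ j → solve 4 (λ a b g c → (a :+ b) :* g :* c := a :* g :* c :+ b :* g :* c)
           refl (x i) (y i) (G i j) (z j))) ⟩
    sumF (λ i → sumF (λ j → x i * G i j * z j + y i * G i j * z j))
      ≡⟨ sumF-cong (λ i → sumF-+ (λ j → x i * G i j * z j) (λ j → y i * G i j * z j)) ⟩
    sumF (λ i → sumF (λ j → x i * G i j * z j) + sumF (λ j → y i * G i j * z j))
      ≡⟨ sumF-+ (λ i → sumF (λ j → x i * G i j * z j)) (λ i → sumF (λ j → y i * G i j * z j)) ⟩
    ⟪ x , z ⟫ + ⟪ y , z ⟫ ∎

  form-·ˡ : ∀ c x z → ⟪ c ·ᵥ x , z ⟫ ≡ c * ⟪ x , z ⟫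
  form-·ˡ c x z = begin
    ⟪ c ·ᵥ x , z ⟫
      ≡⟨ sumF-cong (λ i → sumF-cong (λ j → solve 4 (λ k a g b → k :* a :* g :* b := k :* (a :* g :* b))
           refl c (x i) (G i j) (z j))) ⟩
    sumF (λ i → sumF (λ j → c * (x i * G i j * z j)))
      ≡⟨ sumF-cong (λ i → sumF-*ˡ c (λ j → x i * G i j * z j)) ⟩
    sumF (λ i → c * sumF (λ j → x i * G i j * z j))
      ≡⟨ sumF-*ˡ c (λ i → sumF (λ j → x i * G i j * z j)) ⟩
    c * ⟪ x , z ⟫ ∎

  form-minusˡ : ∀ x y z → ⟪ x -ᵥ y , z ⟫ ≡ ⟪ x , z ⟫ - ⟪ y , z ⟫
  form-minusˡ x y z = begin
    ⟪ x -ᵥ y , z ⟫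
      ≡⟨ form-congˡ z (λ i → solve 2 (λ a b → a :- b := a :+ (:- con 1ℚ) :* b) refl (x i) (y i)) ⟩
    ⟪ x +ᵥ (- 1ℚ) ·ᵥ y , z ⟫       ≡⟨ form-+ˡ x ((- 1ℚ) ·ᵥ y) z ⟩
    ⟪ x , z ⟫ + ⟪ (- 1ℚ) ·ᵥ y , z ⟫ ≡⟨ cong (⟪ x , z ⟫ +_) (form-·ˡ (- 1ℚ) y z) ⟩
    ⟪ x , z ⟫ + - 1ℚ * ⟪ y , z ⟫
      ≡⟨ solve 2 (λ a b → a :+ (:- con 1ℚ) :* b := a :- b) refl ⟪ x , z ⟫ ⟪ y , z ⟫ ⟩
    ⟪ x , z ⟫ - ⟪ y , z ⟫ ∎

  form-+ʳ : ∀ x y z → ⟪ x , y +ᵥ z ⟫ ≡ ⟪ x , y ⟫ + ⟪ x , z ⟫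
  form-+ʳ x y z = begin
    ⟪ x , y +ᵥ z ⟫        ≡⟨ form-sym x (y +ᵥ z) ⟩
    ⟪ y +ᵥ z , x ⟫        ≡⟨ form-+ˡ y z x ⟩
    ⟪ y , x ⟫ + ⟪ z , x ⟫ ≡⟨ cong₂ _+_ (form-sym y x) (form-sym z x) ⟩
    ⟪ x , y ⟫ + ⟪ x , z ⟫ ∎

  form-·ʳ : ∀ c x z → ⟪ x , c ·ᵥ z ⟫ ≡ c * ⟪ x , z ⟫
  form-·ʳ c x z = begin
    ⟪ x , c ·ᵥ z ⟫ ≡⟨ form-sym x (c ·ᵥ z) ⟩
    ⟪ c ·ᵥ z , x ⟫ ≡⟨ form-·ˡ c z x ⟩
    c * ⟪ z , x ⟫  ≡⟨ cong (c *_) (form-sym z x) ⟩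
    c * ⟪ x , z ⟫  ∎

  form-combˡ : ∀ {k} (v : Fin k → V n) (c : Fin k → ℚ) (y : V n) →
    ⟪ comb v c , y ⟫ ≡ sumF (λ j → c j * ⟪ v j , y ⟫)
  form-combˡ {zero}  v c y = form-zeroˡ y
  form-combˡ {suc k} v c y = begin
    ⟪ c zero ·ᵥ v zero +ᵥ comb (λ j → v (suc j)) (λ j → c (suc j)) , y ⟫
      ≡⟨ form-+ˡ (c zero ·ᵥ v zero) (comb (λ j → v (suc j)) (λ j → c (suc j))) y ⟩
    ⟪ c zero ·ᵥ v zero , y ⟫ + ⟪ comb (λ j → v (suc j)) (λ j → c (suc j)) , y ⟫
      ≡⟨ cong₂ _+_ (form-·ˡ (c zero) (v zero) y) (form-combˡ (λ j → v (suc j)) (λ j → c (suc j)) y) ⟩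
    sumF (λ j → c j * ⟪ v j , y ⟫) ∎

  form-combʳ : ∀ {k} (x : V n) (v : Fin k → V n) (c : Fin k → ℚ) →
    ⟪ x , comb v c ⟫ ≡ sumF (λ j → c j * ⟪ x , v j ⟫)
  form-combʳ x v c = begin
    ⟪ x , comb v c ⟫                 ≡⟨ form-sym x (comb v c) ⟩
    ⟪ comb v c , x ⟫                 ≡⟨ form-combˡ v c x ⟩
    sumF (λ j → c j * ⟪ v j , x ⟫)   ≡⟨ sumF-cong (λ j → cong (c j *_) (form-sym (v j) x)) ⟩
    sumF (λ j → c j * ⟪ x , v j ⟫)   ∎

module PositiveDefiniteForm {n : ℕ} (G : Fin n → Fin n → ℚ) (G-sym : ∀ i j → G i j ≡ G j i)
  (G-pos : ∀ (x : V n) → ¬ (x ≈ᵥ 0ᵥ) → 0ℚ < form G x x) where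

  open BilinearForm G G-sym

  private
    ⟪_,_⟫ : V n → V n → ℚ
    ⟪ x , y ⟫ = form G x y

  -- Induction on the family: shear the tail so that it becomes orthogonal to the
  -- head v₀ (Gram–Schmidt), solve for the sheared tail, then correct along v₀.
  pairings-prescribable : ∀ {k} (v : Fin k → V n) → LinearIndependent v →
    (r : Fin k → ℚ) → ∃ λ x → ∀ j → ⟪ x , v j ⟫ ≡ r j
  pairings-prescribable {zero}  v independent r = 0ᵥ , λ ()
  pairings-prescribable {suc k} v independent r = x , x-pairing
    where
    v₀ : V n
    v₀ = v zero
    N≢0 : ⟪ v₀ , v₀ ⟫ ≢ 0ℚ
    N≢0 N≡0 = ℚ.<⇒≢ (G-pos v₀ (independent-head-nonzero v independent)) (sym N≡0)
    κ : Fin k → ℚ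
    κ j = ⟪ v (suc j) , v₀ ⟫ * inv ⟪ v₀ , v₀ ⟫
    w : Fin k → V n
    w j = v (suc j) -ᵥ κ j ·ᵥ v₀
    w⊥v₀ : ∀ j → ⟪ v₀ , w j ⟫ ≡ 0ℚ
    w⊥v₀ j = begin
      ⟪ v₀ , w j ⟫                                ≡⟨ form-sym v₀ (w j) ⟩
      ⟪ w j , v₀ ⟫                                ≡⟨ form-minusˡ (v (suc j)) (κ j ·ᵥ v₀) v₀ ⟩
      ⟪ v (suc j) , v₀ ⟫ - ⟪ κ j ·ᵥ v₀ , v₀ ⟫     ≡⟨ cong (_-_ ⟪ v (suc j) , v₀ ⟫) (form-·ˡ (κ j) v₀ v₀) ⟩
      ⟪ v (suc j) , v₀ ⟫ - κ j * ⟪ v₀ , v₀ ⟫      ≡⟨ cong (_-_ ⟪ v (suc j) , v₀ ⟫) (*-inv-cancelʳ _ N≢0) ⟩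
      ⟪ v (suc j) , v₀ ⟫ - ⟪ v (suc j) , v₀ ⟫     ≡⟨ ℚ.+-inverseʳ ⟪ v (suc j) , v₀ ⟫ ⟩
      0ℚ                                          ∎
    tail-solution : ∃ λ y → ∀ j → ⟪ y , w j ⟫ ≡ r (suc j) - κ j * r zero
    tail-solution = pairings-prescribable w (independent-shear κ v independent)
                      (λ j → r (suc j) - κ j * r zero)
    y : V n
    y = proj₁ tail-solution
    λ₀ : ℚ
    λ₀ = (r zero - ⟪ y , v₀ ⟫) * inv ⟪ v₀ , v₀ ⟫
    x : V n
    x = y +ᵥ λ₀ ·ᵥ v₀
    x-pairing₀ : ⟪ x , v₀ ⟫ ≡ r zero
    x-pairing₀ = begin
      ⟪ y +ᵥ λ₀ ·ᵥ v₀ , v₀ ⟫           ≡⟨ form-+ˡ y (λ₀ ·ᵥ v₀) v₀ ⟩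
      ⟪ y , v₀ ⟫ + ⟪ λ₀ ·ᵥ v₀ , v₀ ⟫    ≡⟨ cong (⟪ y , v₀ ⟫ +_) (form-·ˡ λ₀ v₀ v₀) ⟩
      ⟪ y , v₀ ⟫ + λ₀ * ⟪ v₀ , v₀ ⟫     ≡⟨ cong (⟪ y , v₀ ⟫ +_) (*-inv-cancelʳ _ N≢0) ⟩
      ⟪ y , v₀ ⟫ + (r zero - ⟪ y , v₀ ⟫) ≡⟨ solve 2 (λ a b → a :+ (b :- a) := b) refl ⟪ y , v₀ ⟫ (r zero) ⟩
      r zero                             ∎
    x-pairing : ∀ j → ⟪ x , v j ⟫ ≡ r j
    x-pairing zero    = x-pairing₀
    x-pairing (suc j) = begin
      ⟪ x , v (suc j) ⟫
        ≡⟨ form-congʳ x (λ i → solve 3 (λ a k b → a := a :- k :* b :+ k :* b) refl (v (suc j) i) (κ j) (v₀ i)) ⟩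
      ⟪ x , w j +ᵥ κ j ·ᵥ v₀ ⟫
        ≡⟨ form-+ʳ x (w j) (κ j ·ᵥ v₀) ⟩
      ⟪ x , w j ⟫ + ⟪ x , κ j ·ᵥ v₀ ⟫
        ≡⟨ cong₂ _+_ (form-+ˡ y (λ₀ ·ᵥ v₀) (w j)) (form-·ʳ (κ j) x v₀) ⟩
      (⟪ y , w j ⟫ + ⟪ λ₀ ·ᵥ v₀ , w j ⟫) + κ j * ⟪ x , v₀ ⟫
        ≡⟨ cong₂ (λ a b → (⟪ y , w j ⟫ + a) + κ j * b)
             (trans (form-·ˡ λ₀ v₀ (w j)) (cong (λ₀ *_) (w⊥v₀ j))) x-pairing₀ ⟩
      (⟪ y , w j ⟫ + λ₀ * 0ℚ) + κ j * r zero
        ≡⟨ cong (λ a → (a + λ₀ * 0ℚ) + κ j * r zero) (proj₂ tail-solution j) ⟩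
      ((r (suc j) - κ j * r zero) + λ₀ * 0ℚ) + κ j * r zero
        ≡⟨ solve 4 (λ a k b l → ((a :- k :* b) :+ l :* con 0ℚ) :+ k :* b := a) refl (r (suc j)) (κ j) (r zero) λ₀ ⟩
      r (suc j) ∎

module _ {n : ℕ} (R : RootSystem n) where

  open RootSystem R
  open BilinearForm G G-sym
  open PositiveDefiniteForm G G-sym G-pos

  reflect-cong : ∀ β {x x′} → x ≈ᵥ x′ → reflect β x ≈ᵥ reflect β x′
  reflect-cong β x≈x′ i = cong₂ (λ a b → a - b * β i) (x≈x′ i) (form-congˡ (coroot β) x≈x′)

  reflect-pairing : ∀ β x y →
    ⟪ reflect β x , y ⟫ ≡ ⟪ x , y ⟫ - 2ℚ * inv ⟪ β , β ⟫ * (⟪ x , β ⟫ * ⟪ y , β ⟫)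
  reflect-pairing β x y = begin
    ⟪ x -ᵥ ⟪ x , coroot β ⟫ ·ᵥ β , y ⟫          ≡⟨ form-minusˡ x (⟪ x , coroot β ⟫ ·ᵥ β) y ⟩
    ⟪ x , y ⟫ - ⟪ ⟪ x , coroot β ⟫ ·ᵥ β , y ⟫   ≡⟨ cong (_-_ ⟪ x , y ⟫) (form-·ˡ ⟪ x , coroot β ⟫ β y) ⟩
    ⟪ x , y ⟫ - ⟪ x , coroot β ⟫ * ⟪ β , y ⟫
      ≡⟨ cong₂ (λ a b → ⟪ x , y ⟫ - a * b) (form-·ʳ (2ℚ * inv ⟪ β , β ⟫) x β) (form-sym β y) ⟩
    ⟪ x , y ⟫ - 2ℚ * inv ⟪ β , β ⟫ * ⟪ x , β ⟫ * ⟪ y , β ⟫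
      ≡⟨ cong (_-_ ⟪ x , y ⟫) (ℚ.*-assoc (2ℚ * inv ⟪ β , β ⟫) ⟪ x , β ⟫ ⟪ y , β ⟫) ⟩
    ⟪ x , y ⟫ - 2ℚ * inv ⟪ β , β ⟫ * (⟪ x , β ⟫ * ⟪ y , β ⟫) ∎

  reflect-adjoint : ∀ β x y → ⟪ reflect β x , y ⟫ ≡ ⟪ x , reflect β y ⟫
  reflect-adjoint β x y = begin
    ⟪ reflect β x , y ⟫
      ≡⟨ reflect-pairing β x y ⟩
    ⟪ x , y ⟫ - 2ℚ * inv ⟪ β , β ⟫ * (⟪ x , β ⟫ * ⟪ y , β ⟫)
      ≡⟨ cong₂ (λ a b → a - 2ℚ * inv ⟪ β , β ⟫ * b) (form-sym x y) (ℚ.*-comm ⟪ x , β ⟫ ⟪ y , β ⟫) ⟩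
    ⟪ y , x ⟫ - 2ℚ * inv ⟪ β , β ⟫ * (⟪ y , β ⟫ * ⟪ x , β ⟫)
      ≡⟨ reflect-pairing β y x ⟨
    ⟪ reflect β y , x ⟫
      ≡⟨ form-sym (reflect β y) x ⟩
    ⟪ x , reflect β y ⟫ ∎

  act-closed : ∀ (w : Word R) {x} → x ∈Φ → act R w x ∈Φ
  act-closed []      x∈Φ = x∈Φ
  act-closed (i ∷ w) x∈Φ with act-closed w x∈Φ
  ... | k , root-k≈wx with reflect-closed i k
  ... | m , root-m≈sᵢroot-k = m , λ t → trans (root-m≈sᵢroot-k t) (reflect-cong (root i) root-k≈wx t)

  act-adjoint : ∀ (w : Word R) x y → ⟪ act R (inverse R w) x , y ⟫ ≡ ⟪ x , act R w y ⟫
  act-adjoint []      x y = refl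
  act-adjoint (i ∷ w) x y = begin
    ⟪ act R (reverse (i ∷ w)) x , y ⟫
      ≡⟨ cong (λ u → ⟪ act R u x , y ⟫) (List.unfold-reverse i w) ⟩
    ⟪ act R (reverse w ∷ʳ i) x , y ⟫
      ≡⟨ cong ⟪_, y ⟫ (List.foldr-∷ʳ (λ j z → reflect (root j) z) x i (reverse w)) ⟩
    ⟪ act R (reverse w) (reflect (root i) x) , y ⟫
      ≡⟨ act-adjoint w (reflect (root i) x) y ⟩
    ⟪ reflect (root i) x , act R w y ⟫
      ≡⟨ reflect-adjoint (root i) x (act R w y) ⟩
    ⟪ x , act R (i ∷ w) y ⟫ ∎

  module _ (Δ : Fin n → V n) where

    A₀-inhabited : LinearIndependent Δ → (α̃ : V n) → ∃ (InA0 R Δ α̃)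
    A₀-inhabited independent α̃ = ε ·ᵥ x₀ , x-pos , x-below
      where
      x₀-solution : ∃ λ x₀ → ∀ j → ⟪ x₀ , Δ j ⟫ ≡ 1ℚ
      x₀-solution = pairings-prescribable Δ independent (λ _ → 1ℚ)
      x₀ : V n
      x₀ = proj₁ x₀-solution
      ε-choice : ∃ λ ε → 0ℚ < ε × ε * ⟪ x₀ , α̃ ⟫ < 1ℚ
      ε-choice = small-positive-multiplier ⟪ x₀ , α̃ ⟫
      ε : ℚ
      ε = proj₁ ε-choice
      x-pos : ∀ j → 0ℚ < ⟪ ε ·ᵥ x₀ , Δ j ⟫
      x-pos j = subst (0ℚ <_)
        (sym (trans (form-·ˡ ε x₀ (Δ j)) (trans (cong (ε *_) (proj₂ x₀-solution j)) (ℚ.*-identityʳ ε))))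
        (proj₁ (proj₂ ε-choice))
      x-below : ⟪ ε ·ᵥ x₀ , α̃ ⟫ < 1ℚ
      x-below = subst (_< 1ℚ) (sym (form-·ˡ ε x₀ α̃)) (proj₂ (proj₂ ε-choice))

    chamber-pairing-pos : ∀ {y v} → InC R Δ y → NonNegComb R Δ v → ¬ (v ≈ᵥ 0ᵥ) → 0ℚ < ⟪ y , v ⟫
    chamber-pairing-pos {y} {v} y∈C (c , v≈Δc , 0≤c) v≢0 =
      subst (0ℚ <_) (sym (trans (form-congʳ y v≈Δc) (form-combʳ y Δ c)))
        (sumF-pos (λ j → c j * ⟪ y , Δ j ⟫) (λ j → *-nonNeg (0≤c j) (ℚ.<⇒≤ (y∈C j))) (j , 0<cⱼ*⟪y,Δⱼ⟫))
      where
      nonzero-coefficient : ∃ λ j → c j ≢ 0ℚ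
      nonzero-coefficient = comb-nonzero-coefficient Δ c (λ Δc≈0 → v≢0 (λ i → trans (v≈Δc i) (Δc≈0 i)))
      j : Fin n
      j = proj₁ nonzero-coefficient
      0<cⱼ*⟪y,Δⱼ⟫ : 0ℚ < c j * ⟪ y , Δ j ⟫
      0<cⱼ*⟪y,Δⱼ⟫ = *-pos (≤∧≢⇒< (0≤c j) (λ 0≡cⱼ → proj₂ nonzero-coefficient (sym 0≡cⱼ))) (y∈C j)

    positive-if-pairing-pos : IsSimpleSystem R Δ → ∀ {x β} → InC R Δ x →
      β ∈Φ → 0ℚ < ⟪ β , x ⟫ → IsPositive R Δ β
    positive-if-pairing-pos (_ , _ , decomposition) {x} {β} x∈C (k , root-k≈β) 0<⟪β,x⟫
      with decomposition k
    ... | d , root-k≈Δd , inj₁ 0≤d = (k , root-k≈β) , d , β≈Δd , 0≤d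
      where
      β≈Δd : β ≈ᵥ comb Δ d
      β≈Δd i = trans (sym (root-k≈β i)) (root-k≈Δd i)
    ... | d , root-k≈Δd , inj₂ d≤0 = ⊥-elim (ℚ.<-irrefl refl (ℚ.<-≤-trans 0<⟪β,x⟫ ⟪β,x⟫≤0))
      where
      ⟪β,x⟫≤0 : ⟪ β , x ⟫ ≤ 0ℚ
      ⟪β,x⟫≤0 = subst (_≤ 0ℚ)
        (sym (trans (form-congˡ x (λ i → trans (sym (root-k≈β i)) (root-k≈Δd i))) (form-combˡ Δ d x)))
        (sumF-nonPos (λ j → d j * ⟪ Δ j , x ⟫) (λ j → *-nonPos-nonNeg (d≤0 j) (ℚ.<⇒≤ (subst (0ℚ <_) (form-sym x (Δ j)) (x∈C j)))))

lemma2p10 : ∀ {n : ℕ} (R : RootSystem n) → Irreducible R →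
    (Δ : Fin n → V n) → IsSimpleSystem R Δ →
    (αt : V n) → IsHighestRoot R Δ αt →
    (a : Fin (length (RootSystem.Φ R))) → IsPositive R Δ (RootSystem.root R a) →
    (q : V n) → InCorootLattice R q → (s : Word R) →
    Dominant R Δ αt q s →
    RootSystem.⟪_,_⟫ R (RootSystem.root R a) q ≡ 0ℚ →
    IsPositive R Δ (act R (inverse R s) (RootSystem.root R a))
lemma2p10 {n} R _ Δ Δ-simple@(_ , Δ-independent , _) αt _ a (_ , α-nonneg) q _ s dominant ⟪α,q⟫≡0 =
  positive-if-pairing-pos R Δ Δ-simple
    (proj₁ x∈A₀)
    (act-closed R (inverse R s) (a , λ _ → refl))
    (subst (0ℚ <_) ⟪α,q+sx⟫≡⟪s⁻¹α,x⟫
      (chamber-pairing-pos R Δ {affAct R q s x} (dominant x x∈A₀) α-nonneg (nonzero a)))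
  where
  open RootSystem R
  open BilinearForm G G-sym
  x : V n
  x = proj₁ (A₀-inhabited R Δ Δ-independent αt)
  x∈A₀ : InA0 R Δ αt x
  x∈A₀ = proj₂ (A₀-inhabited R Δ Δ-independent αt)
  ⟪α,q+sx⟫≡⟪s⁻¹α,x⟫ : ⟪ affAct R q s x , root a ⟫ ≡ ⟪ act R (inverse R s) (root a) , x ⟫
  ⟪α,q+sx⟫≡⟪s⁻¹α,x⟫ = begin
    ⟪ q +ᵥ act R s x , root a ⟫           ≡⟨ form-sym (q +ᵥ act R s x) (root a) ⟩
    ⟪ root a , q +ᵥ act R s x ⟫           ≡⟨ form-+ʳ (root a) q (act R s x) ⟩
    ⟪ root a , q ⟫ + ⟪ root a , act R s x ⟫ ≡⟨ cong (_+ ⟪ root a , act R s x ⟫) ⟪α,q⟫≡0 ⟩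
    0ℚ + ⟪ root a , act R s x ⟫           ≡⟨ ℚ.+-identityˡ _ ⟩
    ⟪ root a , act R s x ⟫                ≡⟨ act-adjoint R s (root a) x ⟨
    ⟪ act R (inverse R s) (root a) , x ⟫  ∎
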